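{- Let $S$ be a set of nonempty binary strings and $l\ge1$ an integer such that every element of $S$ has length at least $l+1$, and such that for every $s\in S$ both the $(l-1)$-flip and the $l$-flip of $s$ have risk at most $l-1$. Then the Obscurer wins the Renyi-Ulam game with lie restriction $r(S)$ (i.e., there is some $n$ for which the Seeker does not win).
   Context: For a set $S$ of nonempty binary strings, $r(S)$ is the set of finite binary strings containing no element of $S$ as a contiguous substring. The risk of a binary string $p$ (with respect to $S$) is the length of the longest suffix of $p$ that is a prefix of some element of $S$. For $p=a_1a_2\dots a_m$ with $m\ge l+1$, its $l$-flip is $a_1a_2\dots a_l\overline{a_{l+1}}$, where $\overline{a}$ is the complementary bit (so the $0$-flip is $\overline{a_1}$). Renyi-Ulam game with lie restriction $R$: the Obscurer picks $x\in\{1,\dots,n\}$; each turn the Seeker asks whether $x$ lies in a chosen subset and the Obscurer answers yes or no. The lie pattern of a candidate $y$ is the binary string whose $i$-th bit is $1$ iff the $i$-th answer is false for $y$; the Obscurer's answers must keep her number's lie pattern in $R$. The Seeker wins for $n$ if he has an adaptive strategy guaranteeing after finitely many questions that at most one $y\in\{1,\dots,n\}$ has lie pattern in $R$; the Obscurer wins if for some $n$ the Seeker does not win. -}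

module Defs where

open import Level using (0ℓ)
open import Data.Bool using (Bool; true; false; not; _xor_)
open import Data.Nat using (ℕ; zero; suc; _≤_)
open import Data.Fin using (Fin)
open import Data.List using (List; []; _∷_; _++_; [_]; length)
open import Data.Product using (∃; ∃₂; _×_)
open import Relation.Binary.PropositionalEquality using (_≡_)
open import Relation.Nullary using (¬_)
open import Relation.Unary using (Pred)

-- binary strings; bit 1 = true
BinStr : Set
BinStr = List Bool

StrSet : Set₁
StrSet = Pred BinStr 0ℓ

Infix : BinStr → BinStr → Set
Infix s w = ∃₂ λ u v → u ++ s ++ v ≡ w

IsPrefix : BinStr → BinStr → Set
IsPrefix q s = ∃ λ v → q ++ v ≡ s

IsSuffix : BinStr → BinStr → Set
IsSuffix q p = ∃ λ u → u ++ q ≡ p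

r : StrSet → StrSet
r S w = ∀ s → S s → ¬ Infix s w

-- "risk of p w.r.t. S is at most k": the longest suffix of p that is a
-- prefix of some element of S has length ≤ k, i.e. every such suffix does.
RiskAtMost : StrSet → BinStr → ℕ → Set
RiskAtMost S p k = ∀ q → IsSuffix q p → (∃ λ s → S s × IsPrefix q s) → length q ≤ k

-- l-flip of a1..am : a1..al (not a_{l+1})   (meaningful when m ≥ l+1)
flip : ℕ → BinStr → BinStr
flip _       []       = []
flip zero    (a ∷ _)  = [ not a ]
flip (suc l) (a ∷ as) = a ∷ flip l as

-- Game states: the lie pattern so far of each candidate y ∈ {1..n} (as Fin n).
State : ℕ → Set
State n = Fin n → BinStr

-- After question "is x ∈ Q?" answered `ans`, candidate y gets lie bit 1
-- iff the answer is false for y, i.e. iff (Q y) ≠ ans.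
update : ∀ {n} → State n → (Fin n → Bool) → Bool → State n
update st Q ans y = st y ++ [ Q y xor ans ]

AtMostOneIn : ∀ {n} → StrSet → State n → Set
AtMostOneIn R st = ∀ y z → R (st y) → R (st z) → y ≡ z

-- The Seeker has an adaptive strategy from state st that, against every
-- sequence of answers, terminates after finitely many questions with at most
-- one candidate whose lie pattern is in R. (Answers that would leave no
-- candidate in R are harmless: the Seeker has then already won.)
data SeekerWinsFrom {n : ℕ} (R : StrSet) : State n → Set where
  done : ∀ {st} → AtMostOneIn R st → SeekerWinsFrom R st
  ask  : ∀ {st} (Q : Fin n → Bool) →
         (∀ ans → SeekerWinsFrom R (update st Q ans)) → SeekerWinsFrom R st

SeekerWins : StrSet → ℕ → Set
SeekerWins R n = SeekerWinsFrom {n} R (λ _ → [])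

ObscurerWins : StrSet → Set
ObscurerWins R = ∃ λ n → ¬ SeekerWins R n

-- The Obscurer already wins with two candidates.  Call a lie pattern k-safe if it
-- avoids S and has risk at most k.  She keeps one candidate (l−1)-safe and the
-- other l-safe.  Appending any bit to an (l−1)-safe pattern leaves it l-safe,
-- since every element of S is longer than l.  From an l-safe pattern p some bit
-- brings the risk back to l−1: if the longest suffix q of p that begins an
-- element s of S has length l or l−1, then q followed by the flipped next bit
-- of s is the |q|-flip of s, whose risk is at most l−1 by hypothesis, and the
-- risk of p·b is bounded by that of q·b; if it is shorter, any bit will do.
-- She answers so that the l-safe candidate receives that bit; the two
-- candidates swap roles and both stay alive forever.
module Submission where

open import Defs
open import Data.Nat using (ℕ; suc; _≤_; _<_; _∸_; z≤n; s≤s)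
open import Data.Nat.Properties using (≤-trans; n≤1+n; ≤-pred; ≤∧≢⇒<; <⇒≱; <-irrefl)
open import Data.List using (List; []; _∷_; _++_; [_]; _∷ʳ_; length; initLast; _∷ʳ′_)
open import Data.List.Properties
  using (++-assoc; ++-identityʳ; ∷-injectiveʳ; ∷ʳ-injective; length-++-≤ʳ; length-++-comm; ++-conicalˡ; ++-conicalʳ)
open import Data.Bool using (false; not; _xor_)
open import Data.Bool.Properties using (xor-assoc; xor-same)
import Data.Fin as Fin
open import Data.Product using (∃; _×_; _,_; proj₁)
open import Data.Sum using (_⊎_; inj₁; inj₂)
open import Relation.Nullary using (¬_; Dec; yes; no; contradiction)
open import Relation.Nullary.Decidable using (¬¬-excluded-middle)
open import Relation.Nullary.Negation using (¬¬-map)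
open import Relation.Binary.PropositionalEquality hiding ([_])

++-≡-∷ʳ⁻ : ∀ {A : Set} (xs ys zs : List A) {z} → xs ++ ys ≡ zs ∷ʳ z →
           ys ≡ [] ⊎ ∃ λ ys′ → ys ≡ ys′ ∷ʳ z × xs ++ ys′ ≡ zs
++-≡-∷ʳ⁻ xs ys zs eq with initLast ys
... | []        = inj₁ refl
... | ys′ ∷ʳ′ y with ∷ʳ-injective (xs ++ ys′) zs (trans (++-assoc xs ys′ [ y ]) eq)
...   | eq′ , refl = inj₂ (ys′ , refl , eq′)

suffix-of-suffix : ∀ {A : Set} (u w a c : List A) → u ++ a ≡ w ++ c →
                   length a ≤ length c → ∃ λ t → t ++ a ≡ c
suffix-of-suffix u       []      a c eq   _ = u , eq
suffix-of-suffix []      (x ∷ w) a c refl a≤c = contradiction a≤c (<⇒≱ (s≤s (length-++-≤ʳ c {w})))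
suffix-of-suffix (_ ∷ u) (_ ∷ w) a c eq   a≤c = suffix-of-suffix u w a c (∷-injectiveʳ eq) a≤c

suffix-∷ʳ⁻ : ∀ {q p b} → IsSuffix q (p ∷ʳ b) →
             q ≡ [] ⊎ ∃ λ q′ → q ≡ q′ ∷ʳ b × IsSuffix q′ p
suffix-∷ʳ⁻ {q} {p} (u , eq) with ++-≡-∷ʳ⁻ u q p eq
... | inj₁ q≡[]                = inj₁ q≡[]
... | inj₂ (q′ , q≡q′b , eq′) = inj₂ (q′ , q≡q′b , u , eq′)

suffix-∷ʳ⁺ : ∀ {q p} b → IsSuffix q p → IsSuffix (q ∷ʳ b) (p ∷ʳ b)
suffix-∷ʳ⁺ {q} b (u , refl) = u , sym (++-assoc u q [ b ])

prefix-∷ʳ⁻ : ∀ {q s b} → IsPrefix (q ∷ʳ b) s → IsPrefix q s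
prefix-∷ʳ⁻ {q} {b = b} (v , eq) = b ∷ v , trans (sym (++-assoc q [ b ] v)) eq

flip-length : ∀ q c v → flip (length q) (q ++ c ∷ v) ≡ q ∷ʳ not c
flip-length []      c v = refl
flip-length (x ∷ q) c v = cong (x ∷_) (flip-length q c v)

flip-prefix : ∀ {q s} → IsPrefix q s → length q < length s → ∃ λ b → flip (length q) s ≡ q ∷ʳ b
flip-prefix {q} ([]    , refl) q<s = contradiction q<s (<-irrefl (sym (cong length (++-identityʳ q))))
flip-prefix {q} (c ∷ v , refl) _   = not c , flip-length q c v

module _ (S : StrSet) where

  IsPrefixOfSome : BinStr → Set
  IsPrefixOfSome q = ∃ λ s → S s × IsPrefix q s

  RiskBelow : BinStr → ℕ → Set
  RiskBelow p k = ∀ q → IsSuffix q p → IsPrefixOfSome q → length q < k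

  RiskAtLeast : BinStr → ℕ → Set
  RiskAtLeast p k = ∃ λ q → IsSuffix q p × IsPrefixOfSome q × length q ≡ k

  Safe : ℕ → BinStr → Set
  Safe k p = r S p × RiskAtMost S p k

  IsPrefixOfSome-∷ʳ⁻ : ∀ {q b} → IsPrefixOfSome (q ∷ʳ b) → IsPrefixOfSome q
  IsPrefixOfSome-∷ʳ⁻ (s , Ss , pre) = s , Ss , prefix-∷ʳ⁻ pre

  RiskAtMost⇒RiskBelow : ∀ {p k} → RiskAtMost S p k → RiskBelow p (suc k)
  RiskAtMost⇒RiskBelow R q sq th = s≤s (R q sq th)

  RiskBelow⇒RiskAtMost : ∀ {p k} → RiskBelow p (suc k) → RiskAtMost S p k
  RiskBelow⇒RiskAtMost below q sq th = ≤-pred (below q sq th)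

  RiskBelow⇒RiskAtMost-∷ʳ : ∀ {p k} b → RiskBelow p k → RiskAtMost S (p ∷ʳ b) k
  RiskBelow⇒RiskAtMost-∷ʳ b below q sq th with suffix-∷ʳ⁻ sq
  ... | inj₁ refl               = z≤n
  ... | inj₂ (q′ , refl , sq′) =
    subst (_≤ _) (length-++-comm [ b ] q′) (below q′ sq′ (IsPrefixOfSome-∷ʳ⁻ th))

  -- A suffix of p·b that begins an element of S is q′·b with q′ such a suffix of p,
  -- hence a suffix of q, the longest one.
  RiskAtMost-∷ʳ-via-suffix : ∀ {p q b m} → IsSuffix q p → RiskAtMost S p (length q) →
                             RiskAtMost S (q ∷ʳ b) m → RiskAtMost S (p ∷ʳ b) m
  RiskAtMost-∷ʳ-via-suffix {q = q} {b} (w , w++q≡p) Rp Rq q″ sq th with suffix-∷ʳ⁻ sq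
  ... | inj₁ refl                      = z≤n
  ... | inj₂ (q′ , refl , u , u++q′≡p)
    with suffix-of-suffix u w q′ q (trans u++q′≡p (sym w++q≡p))
                          (Rp q′ (u , u++q′≡p) (IsPrefixOfSome-∷ʳ⁻ th))
  ...   | t , t++q′≡q = Rq (q′ ∷ʳ b) (suffix-∷ʳ⁺ b (t , t++q′≡q)) th

  -- S is an arbitrary predicate, so the risk cannot be computed; the case split
  -- on whether it is attained is only available under double negation.
  risk-attained-or-below : ∀ {p k} → RiskAtMost S p k → ¬ ¬ (RiskAtLeast p k ⊎ RiskBelow p k)
  risk-attained-or-below {p} {k} R = ¬¬-map attained? ¬¬-excluded-middle
    where
    attained? : Dec (RiskAtLeast p k) → RiskAtLeast p k ⊎ RiskBelow p k
    attained? (yes attained) = inj₁ attained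
    attained? (no ¬attained) =
      inj₂ λ q sq th → ≤∧≢⇒< (R q sq th) λ |q|≡k → ¬attained (q , sq , th , |q|≡k)

  flip-escapes : ∀ {p k m} → (∀ s → S s → k < length s) →
                 (∀ s → S s → RiskAtMost S (flip k s) m) →
                 RiskAtMost S p k → RiskAtLeast p k → ∃ λ b → RiskAtMost S (p ∷ʳ b) m
  flip-escapes long flip-risk Rp (q , sq , (s , Ss , pre) , refl) with flip-prefix pre (long s Ss)
  ... | b , flip≡qb =
    b , RiskAtMost-∷ʳ-via-suffix sq Rp (subst (λ t → RiskAtMost S t _) flip≡qb (flip-risk s Ss))

  r-∷ʳ : ∀ {p b k} → (∀ s → S s → k < length s) → r S p → RiskAtMost S (p ∷ʳ b) k → r S (p ∷ʳ b)
  r-∷ʳ {p} {b} long avoid R s Ss (u , v , eq) with ++-≡-∷ʳ⁻ (u ++ s) v p (trans (++-assoc u s v) eq)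
  ... | inj₁ refl = <⇒≱ (long s Ss) (R s (u , trans (cong (u ++_) (sym (++-identityʳ s))) eq)
                                          (s , Ss , [] , ++-identityʳ s))
  ... | inj₂ (v′ , refl , eq′) = avoid s Ss (u , v′ , trans (sym (++-assoc u s v′)) eq′)

  Safe-[] : (∀ s → S s → s ≢ []) → ∀ k → Safe k []
  Safe-[] nonempty k = avoid , λ q sq _ → subst (λ t → length t ≤ k) (sym (suffix-[] sq)) z≤n
    where
    suffix-[] : ∀ {q} → IsSuffix q [] → q ≡ []
    suffix-[] (u , eq) = ++-conicalʳ u _ eq
    avoid : r S []
    avoid s Ss (u , v , eq) = nonempty s Ss (++-conicalˡ s v (++-conicalʳ u (s ++ v) eq))

  Safe-∷ʳ : ∀ {p k} b → (∀ s → S s → suc k < length s) → Safe k p → Safe (suc k) (p ∷ʳ b)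
  Safe-∷ʳ {p} {k} b long (avoid , R) = r-∷ʳ long avoid R′ , R′
    where
    R′ : RiskAtMost S (p ∷ʳ b) (suc k)
    R′ = RiskBelow⇒RiskAtMost-∷ʳ b (RiskAtMost⇒RiskBelow R)

-- Here l is one less than the l of the theorem.
module Obscurer (S : StrSet) (l : ℕ)
  (long : ∀ s → S s → suc l < length s)
  (flip-l-risk : ∀ s → S s → RiskAtMost S (flip l s) l)
  (flip-suc-l-risk : ∀ s → S s → RiskAtMost S (flip (suc l) s) l)
  where

  long′ : ∀ s → S s → l < length s
  long′ s Ss = ≤-trans (n≤1+n _) (long s Ss)

  exists-bit-lowering-risk : ∀ {p} → RiskAtMost S p (suc l) → ¬ ¬ ∃ λ b → RiskAtMost S (p ∷ʳ b) l
  exists-bit-lowering-risk Rp no-bit = risk-attained-or-below S Rp λ where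
    (inj₁ attained) → no-bit (flip-escapes S long flip-suc-l-risk Rp attained)
    (inj₂ below)    → let Rp′ = RiskBelow⇒RiskAtMost S below in
      risk-attained-or-below S Rp′ λ where
        (inj₁ attained) → no-bit (flip-escapes S long′ flip-l-risk Rp′ attained)
        (inj₂ below′)   → no-bit (false , RiskBelow⇒RiskAtMost-∷ʳ S false below′)

  Safe-rescue : ∀ {p} → Safe S (suc l) p → ¬ ¬ ∃ λ b → Safe S l (p ∷ʳ b)
  Safe-rescue (avoid , Rp) =
    ¬¬-map (λ (b , R) → b , r-∷ʳ S long′ avoid R , R)
           (exists-bit-lowering-risk Rp)

  -- To give z the lie bit b to the question Q, the Obscurer answers Q z xor b.
  seeker-loses : ∀ {n} {st : State n} y z → y ≢ z → Safe S l (st y) → Safe S (suc l) (st z) →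
                 ¬ SeekerWinsFrom (r S) st
  seeker-loses y z y≢z safe-y safe-z (done at-most-one) =
    y≢z (at-most-one y z (proj₁ safe-y) (proj₁ safe-z))
  seeker-loses {st = st} y z y≢z safe-y safe-z (ask Q next) = Safe-rescue safe-z λ (b , safe-zb) →
    seeker-loses z y (≢-sym y≢z)
      (subst (Safe S l) (cong (st z ∷ʳ_) (sym (xor-cancelˡ (Q z) b))) safe-zb)
      (Safe-∷ʳ S _ long safe-y)
      (next (Q z xor b))
    where
    xor-cancelˡ : ∀ x b → x xor (x xor b) ≡ b
    xor-cancelˡ x b = trans (sym (xor-assoc x x b)) (cong (_xor b) (xor-same x))

lemma1 : (S : StrSet) (l : ℕ) → 1 ≤ l →
         (∀ s → S s → s ≢ []) →
         (∀ s → S s → suc l ≤ length s) →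
         (∀ s → S s → RiskAtMost S (flip (l ∸ 1) s) (l ∸ 1)) →
         (∀ s → S s → RiskAtMost S (flip l s) (l ∸ 1)) →
         ObscurerWins (r S)
lemma1 S (suc l) _ nonempty long flip-l-risk flip-suc-l-risk =
  2 , Obscurer.seeker-loses S l long flip-l-risk flip-suc-l-risk
        Fin.zero (Fin.suc Fin.zero) (λ ()) (Safe-[] S nonempty l) (Safe-[] S nonempty (suc l))
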